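{- Let $n\in\mathbb{N}$, $\varkappa=(\varkappa_1,\ldots,\varkappa_n)\in\mathbb{N}^n$, $N\coloneqq|\varkappa|=\varkappa_1+\cdots+\varkappa_n$, and $\lambda$ an integer partition of length $\le N$. Then \[ G_{\lambda}(y,\varkappa)=J_{\lambda}(y^{[\varkappa]})\,M(y,\varkappa). \]
   Context: Let $y=(y_1,\ldots,y_n)$ be variables. For a list $\mu=(\mu_1,\ldots,\mu_n)$ of nonnegative integers, $y^{[\mu]}$ denotes the list in which $y_1$ is repeated $\mu_1$ times, then $y_2$ repeated $\mu_2$ times, and so on up to $y_n$ repeated $\mu_n$ times. Let $\mathrm{h}_m$ denote the complete homogeneous symmetric polynomial of degree $m$ (with $\mathrm{h}_m=0$ for $m<0$, $\mathrm{h}_0=1$), and $e_l$ the elementary symmetric polynomial of degree $l$ (with $e_l=0$ for $l<0$ or $l$ exceeding the number of variables, $e_0=1$). We use the convention $\lambda_j=0$ for $j$ greater than the length of $\lambda$. For each $p\in\{1,\ldots,N\}$, let $(q,r)$ be the unique pair with $q\in\{1,\ldots,n\}$, $r\in\{1,\ldots,\varkappa_q\}$ and $p=\varkappa_1+\cdots+\varkappa_{q-1}+r$. $G_\lambda(y,\varkappa)$ is the $N\times N$ matrix with entries ($j,p\in\{1,\ldots,N\}$, $(q,r)$ associated to $p$) \[ G_\lambda(y,\varkappa)_{j,p}=\begin{cases}\binom{N+\lambda_j-j}{r-1}\,y_q^{\,N+\lambda_j-j-r+1}, & \text{if } N+\lambda_j-j-r+1\ge 0,\\ 0,&\text{otherwise}.\end{cases}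 \] $J_\lambda(x)$ is the Jacobi--Trudi matrix $J_\lambda(x)=\bigl[\mathrm{h}_{\lambda_j-j+k}(x)\bigr]_{j,k=1}^N$, here evaluated at $x=y^{[\varkappa]}$. $M(y,\varkappa)$ is the $N\times N$ matrix with entries ($k,p\in\{1,\ldots,N\}$, $(q,r)$ associated to $p$) \[ M(y,\varkappa)_{k,p}=(-1)^{N-k-r+1}\,e_{N-k-r+1}\bigl(y^{[\varkappa-r b_q]}\bigr), \] where $b_q=(\delta_{q,m})_{m=1}^n$ is the $q$-th standard basis vector, so that $y^{[\varkappa-r b_q]}=(y_1^{[\varkappa_1]},\ldots,y_{q-1}^{[\varkappa_{q-1}]},y_q^{[\varkappa_q-r]},y_{q+1}^{[\varkappa_{q+1}]},\ldots,y_n^{[\varkappa_n]})$. -}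

module Defs where

open import Algebra.Bundles using (CommutativeRing)
open import Data.Nat using (ℕ; zero; suc; _∸_; _≤_; _<_; _≥_; _≤ᵇ_) renaming (_+_ to _+ℕ_)
open import Data.Nat.Combinatorics using (_C_)
open import Data.Fin using (Fin; zero; suc; toℕ; splitAt)
open import Data.Vec using (Vec; []; _∷_; sum; lookup; updateAt)
open import Data.List using (List; []; _∷_; _++_; replicate)
open import Data.List.Relation.Unary.All using (All)
open import Data.List.Relation.Unary.Linked using (Linked)
open import Data.Product using (_×_; _,_)
open import Data.Sum using (inj₁; inj₂)
open import Data.Bool using (if_then_else_)

IsPartition : List ℕ → Set
IsPartition lam = All (0 <_) lam × Linked _≥_ lam

-- nth lam i = λ_{i+1}, with λ_j = 0 beyond the length.
nth : List ℕ → ℕ → ℕ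
nth [] _ = 0
nth (x ∷ xs) zero = x
nth (x ∷ xs) (suc i) = nth xs i

-- The decomposition p = κ_1 + ... + κ_{q-1} + r, with r ∈ {1..κ_q}
-- (p given 0-based as an element of Fin |κ|; r returned as a natural, 1-based).
decomp : ∀ {n} (κ : Vec ℕ n) → Fin (sum κ) → Fin n × ℕ
decomp (k ∷ κ) i with splitAt k i
... | inj₁ a = zero , suc (toℕ a)
... | inj₂ b with decomp κ b
...   | q , r = suc q , r

module _ {c ℓ} (R : CommutativeRing c ℓ) where
  open CommutativeRing R using (Carrier; _+_; _*_; -_; 0#; 1#)

  fromℕ : ℕ → Carrier
  fromℕ zero = 0#
  fromℕ (suc k) = 1# + fromℕ k

  pow : Carrier → ℕ → Carrier
  pow x zero = 1#
  pow x (suc k) = x * pow x k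

  sumF : (k : ℕ) → (Fin k → Carrier) → Carrier
  sumF zero f = 0#
  sumF (suc k) f = f zero + sumF k (λ i → f (suc i))

  -- complete homogeneous symmetric polynomial h_m (sum of all monomials of
  -- degree m), split according to the exponent i of the first variable
  hc : ℕ → List Carrier → Carrier
  hc zero [] = 1#
  hc (suc m) [] = 0#
  hc m (x ∷ xs) = sumF (suc m) (λ i → pow x (toℕ i) * hc (m ∸ toℕ i) xs)

  el : ℕ → List Carrier → Carrier
  el zero _ = 1#
  el (suc l) [] = 0#
  el (suc l) (x ∷ xs) = el (suc l) xs + x * el l xs

  rep : ∀ {n} → Vec Carrier n → Vec ℕ n → List Carrier
  rep [] [] = []
  rep (y ∷ ys) (m ∷ ms) = replicate m y ++ rep ys ms

  repMinus : ∀ {n} → Vec Carrier n → Vec ℕ n → Fin n → ℕ → List Carrier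
  repMinus y κ q r = rep y (updateAt κ q (_∸ r))

  Matrix : ℕ → Set c
  Matrix N = Fin N → Fin N → Carrier

  matMul : ∀ {N} → Matrix N → Matrix N → Matrix N
  matMul {N} A B j p = sumF N (λ k → A j k * B k p)

  -- All indices below: j = toℕ jf + 1, k = toℕ kf + 1 (1-based as in the paper).

  Gmat : ∀ {n} → Vec Carrier n → (κ : Vec ℕ n) → List ℕ → Matrix (sum κ)
  Gmat y κ lam jf pf with decomp κ pf
  ... | q , r =
    let N = sum κ
        j = suc (toℕ jf)
        a = N +ℕ nth lam (toℕ jf) ∸ j      -- = N + λ_j - j  (≥ 0 as j ≤ N)
    in if r ≤ᵇ suc a
       then fromℕ (a C (r ∸ 1)) * pow (lookup y q) (suc a ∸ r)
       else 0#

  Jmat : ∀ {n} → Vec Carrier n → (κ : Vec ℕ n) → List ℕ → Matrix (sum κ)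
  Jmat y κ lam jf kf =
    let j = suc (toℕ jf)
        k = suc (toℕ kf)
        lj = nth lam (toℕ jf)
    in if j ≤ᵇ lj +ℕ k then hc (lj +ℕ k ∸ j) (rep y κ) else 0#

  Mmat : ∀ {n} → Vec Carrier n → (κ : Vec ℕ n) → Matrix (sum κ)
  Mmat y κ kf pf with decomp κ pf
  ... | q , r =
    let N = sum κ
        k = suc (toℕ kf)
        d = suc N ∸ (k +ℕ r)                -- = N - k - r + 1 when ≥ 0
    in if k +ℕ r ≤ᵇ suc N
       then pow (- 1#) d * el d (repMinus y κ q r)
       else 0#

-- Write x = y^[κ], and for the column p ↔ (q, r) split x = P ++ c^r ++ B with c = y_q, so
-- that y^[κ - r b_q] = P ++ B.  With E(X) = ∏(1 - x t) and H(X) = ∏(1 - x t)⁻¹ one has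
-- E(P ++ B) · H(P ++ c^r ++ B) = H(c^r), i.e. Σᵢ (-1)ⁱ eᵢ(P ++ B) h_{s-i}(x) = h_s(c^r)
-- = C(s + r - 1, r - 1) c^s.  After the substitution i = N - k - r + 1 the (j, p) entry of
-- J_λ · M is exactly this sum for s = N + λ_j - j - r + 1, which is the (j, p) entry of G_λ.
module Submission where

open import Defs
open import Algebra.Bundles using (CommutativeRing)
open import Data.Bool using (Bool; true; false; T; if_then_else_)
open import Data.Fin using (Fin; zero; suc; toℕ; splitAt)
open import Data.Fin.Properties using (toℕ<n)
open import Data.List using (List; []; _∷_; _++_; replicate; length)
open import Data.List.Properties using (length-++; length-replicate; ++-assoc; ++-identityʳ)
open import Data.Nat using (ℕ; zero; suc; _∸_; _≤_; _<_; _≤ᵇ_; _≤?_; s≤s) renaming (_+_ to _+ℕ_)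
open import Data.Nat.Properties
  using (≤⇒≤ᵇ; ≤ᵇ⇒≤; <⇒≱; ≰⇒>; ≤-pred; m≤m+n; m≤n⇒∃[o]m+o≡n; m∸n+n≡m; m+[n∸m]≡n;
         m<n⇒m<1+n; m+n∸m≡n; +-suc; +-cancelˡ-≡; +-cancelʳ-≡; ≤-trans)
import Data.Nat.Properties as ℕ
open import Data.Nat.Combinatorics using (_C_; nCn≡1; nCk+nC[k+1]≡[n+1]C[k+1])
open import Data.Nat.Tactic.RingSolver using (solve-∀)
open import Data.Product using (_×_; _,_)
open import Data.Sum using (inj₁; inj₂)
open import Data.Unit using (tt)
open import Data.Vec using (Vec; []; _∷_; sum; lookup)
open import Relation.Nullary using (¬_; yes; no; contradiction)
open import Relation.Binary.PropositionalEquality as ≡ using (_≡_)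

if-true : ∀ {a} {A : Set a} {b : Bool} {x y : A} → T b → (if b then x else y) ≡ x
if-true {b = true} _ = ≡.refl

if-false : ∀ {a} {A : Set a} {b : Bool} {x y : A} → ¬ T b → (if b then x else y) ≡ y
if-false {b = false} _ = ≡.refl
if-false {b = true} ¬t = contradiction tt ¬t

replicate-+ : ∀ {a} {A : Set a} m n (x : A) → replicate (m +ℕ n) x ≡ replicate m x ++ replicate n x
replicate-+ zero n x = ≡.refl
replicate-+ (suc m) n x = ≡.cong (x ∷_) (replicate-+ m n x)

+-difference-transfer : ∀ n d n' m' → (n +ℕ d) +ℕ n' ≡ m' +ℕ n → n' +ℕ d ≡ m'
+-difference-transfer n d n' m' e = +-cancelʳ-≡ n _ _ (≡.trans (swap n d n') e)
  where
  swap : ∀ n d n' → (n' +ℕ d) +ℕ n ≡ (n +ℕ d) +ℕ n'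
  swap = solve-∀

+-deficit-transfer : ∀ m d n' m' → m +ℕ n' ≡ m' +ℕ (suc m +ℕ d) → n' ≡ suc m' +ℕ d
+-deficit-transfer m d n' m' e = +-cancelˡ-≡ m _ _ (≡.trans e (swap m d m'))
  where
  swap : ∀ m d m' → m' +ℕ (suc m +ℕ d) ≡ m +ℕ (suc m' +ℕ d)
  swap = solve-∀

module _ {c ℓ} (R : CommutativeRing c ℓ) where
  open CommutativeRing R hiding (zero)
  open import Algebra.Properties.Ring ring using (-1*x≈-x; -‿distribˡ-*)
  open import Algebra.Properties.CommutativeSemigroup *-commutativeSemigroup using (x∙yz≈y∙xz)
  open import Relation.Binary.Reasoning.Setoid setoid
  open import Algebra.Solver.Ring.NaturalCoefficients.Default commutativeSemiring
    using (solve; _:=_; _:+_; _:*_)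

  -- atDiff F m n stands for F (m - n), read as 0 when m < n: every entry of G, J and M
  -- has this shape.
  atDiff : (ℕ → Carrier) → ℕ → ℕ → Carrier
  atDiff F m n = if n ≤ᵇ m then F (m ∸ n) else 0#

  atDiff-≤ : ∀ F {m n} → n ≤ m → atDiff F m n ≡ F (m ∸ n)
  atDiff-≤ F n≤m = if-true (≤⇒≤ᵇ n≤m)

  atDiff-< : ∀ F {m n} → m < n → atDiff F m n ≡ 0#
  atDiff-< F {m} {n} m<n = if-false (λ t → <⇒≱ m<n (≤ᵇ⇒≤ n m t))

  atDiff-+ : ∀ F n d → atDiff F (n +ℕ d) n ≡ F d
  atDiff-+ F n d = ≡.trans (atDiff-≤ F (m≤m+n n d)) (≡.cong F (m+n∸m≡n n d))

  atDiff-cong : ∀ F m n m' n' → m +ℕ n' ≡ m' +ℕ n → atDiff F m n ≡ atDiff F m' n'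
  atDiff-cong F m n m' n' e with n ≤? m
  ... | yes n≤m with m≤n⇒∃[o]m+o≡n n≤m
  ...   | d , ≡.refl rewrite ≡.sym (+-difference-transfer n d n' m' e) =
    ≡.trans (atDiff-+ F n d) (≡.sym (atDiff-+ F n' d))
  atDiff-cong F m n m' n' e | no n≰m with m≤n⇒∃[o]m+o≡n (≰⇒> n≰m)
  ...   | d , ≡.refl rewrite +-deficit-transfer m d n' m' e =
    ≡.trans (atDiff-< F (s≤s (m≤m+n m d))) (≡.sym (atDiff-< F (s≤s (m≤m+n m' d))))

  if-cong : ∀ (b : Bool) {x y z} → (T b → x ≈ y) → (if b then x else z) ≈ (if b then y else z)
  if-cong true x≈y = x≈y tt
  if-cong false _ = refl

  ∑ : ℕ → (ℕ → Carrier) → Carrier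
  ∑ zero f = 0#
  ∑ (suc n) f = f 0 + ∑ n (λ i → f (suc i))

  sumF-toℕ : ∀ n f → sumF R n (λ i → f (toℕ i)) ≡ ∑ n f
  sumF-toℕ zero f = ≡.refl
  sumF-toℕ (suc n) f = ≡.cong (f 0 +_) (sumF-toℕ n (λ i → f (suc i)))

  ∑-cong : ∀ n {f g} → (∀ i → i < n → f i ≈ g i) → ∑ n f ≈ ∑ n g
  ∑-cong zero _ = refl
  ∑-cong (suc n) f≈g = +-cong (f≈g 0 (s≤s _≤_.z≤n)) (∑-cong n (λ i i<n → f≈g (suc i) (s≤s i<n)))

  ∑-zero : ∀ n {f} → (∀ i → i < n → f i ≈ 0#) → ∑ n f ≈ 0#
  ∑-zero n f≈0 = trans (∑-cong n f≈0) (∑-0# n)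
    where
    ∑-0# : ∀ n → ∑ n (λ _ → 0#) ≈ 0#
    ∑-0# zero = refl
    ∑-0# (suc n) = trans (+-identityˡ _) (∑-0# n)

  ∑-+ : ∀ m n f → ∑ (m +ℕ n) f ≈ ∑ m f + ∑ n (λ i → f (m +ℕ i))
  ∑-+ zero n f = sym (+-identityˡ _)
  ∑-+ (suc m) n f = trans (+-congˡ (∑-+ m n (λ i → f (suc i)))) (sym (+-assoc _ _ _))

  ∑-extend : ∀ m k f → (∀ i → m ≤ i → f i ≈ 0#) → ∑ (m +ℕ k) f ≈ ∑ m f
  ∑-extend m k f f≈0 = begin
    ∑ (m +ℕ k) f                          ≈⟨ ∑-+ m k f ⟩
    ∑ m f + ∑ k (λ i → f (m +ℕ i))
      ≈⟨ +-congˡ (∑-zero k {λ i → f (m +ℕ i)} (λ i _ → f≈0 (m +ℕ i) (m≤m+n m i))) ⟩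
    ∑ m f + 0#                            ≈⟨ +-identityʳ _ ⟩
    ∑ m f                                 ∎

  ∑-reverse : ∀ n f → ∑ n f ≈ ∑ n (λ i → f (n ∸ suc i))
  ∑-reverse zero f = refl
  ∑-reverse (suc n) f = begin
    ∑ (suc n) f                               ≡⟨ ≡.cong (λ k → ∑ k f) (ℕ.+-comm 1 n) ⟩
    ∑ (n +ℕ 1) f                              ≈⟨ ∑-+ n 1 f ⟩
    ∑ n f + (f (n +ℕ 0) + 0#)                 ≈⟨ +-cong (∑-reverse n f) (+-identityʳ _) ⟩
    ∑ n (λ i → f (n ∸ suc i)) + f (n +ℕ 0)    ≈⟨ +-comm _ _ ⟩
    f (n +ℕ 0) + ∑ n (λ i → f (n ∸ suc i))
      ≡⟨ ≡.cong (λ k → f k + ∑ n (λ i → f (n ∸ suc i))) (ℕ.+-identityʳ n) ⟩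
    ∑ (suc n) (λ i → f (suc n ∸ suc i))       ∎

  ∑-linear : ∀ n f g a → ∑ n (λ i → f i + a * g i) ≈ ∑ n f + a * ∑ n g
  ∑-linear zero f g a = sym (trans (+-congˡ (zeroʳ a)) (+-identityʳ 0#))
  ∑-linear (suc n) f g a = begin
    (f 0 + a * g 0) + ∑ n (λ i → f (suc i) + a * g (suc i))  ≈⟨ +-congˡ (∑-linear n _ _ a) ⟩
    (f 0 + a * g 0) + (∑ n (λ i → f (suc i)) + a * ∑ n (λ i → g (suc i)))
      ≈⟨ solve 5 (λ f₀ g₀ a F G → ((f₀ :+ a :* g₀) :+ (F :+ a :* G)) := ((f₀ :+ F) :+ a :* (g₀ :+ G)))
                 refl _ _ _ _ _ ⟩
    (f 0 + ∑ n (λ i → f (suc i))) + a * (g 0 + ∑ n (λ i → g (suc i)))  ∎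

  -- Formal power series in t as coefficient sequences: conv is the product, shift F = t · F and
  -- mulOnePlus a F = (1 + a t) · F.

  conv : (ℕ → Carrier) → (ℕ → Carrier) → ℕ → Carrier
  conv F G s = ∑ (suc s) (λ i → F i * G (s ∸ i))

  shift : (ℕ → Carrier) → ℕ → Carrier
  shift F zero = 0#
  shift F (suc i) = F i

  mulOnePlus : Carrier → (ℕ → Carrier) → ℕ → Carrier
  mulOnePlus a F i = F i + a * shift F i

  conv-cong : ∀ {F F' G G'} → (∀ i → F i ≈ F' i) → (∀ i → G i ≈ G' i) → ∀ s → conv F G s ≈ conv F' G' s
  conv-cong {F} {F'} {G} {G'} F≈F' G≈G' s =
    ∑-cong (suc s) {λ i → F i * G (s ∸ i)} {λ i → F' i * G' (s ∸ i)} (λ i _ → *-cong (F≈F' i) (G≈G' (s ∸ i)))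

  conv-linearˡ : ∀ F F' G a s → conv (λ i → F i + a * F' i) G s ≈ conv F G s + a * conv F' G s
  conv-linearˡ F F' G a s = trans
    (∑-cong (suc s) {λ i → (F i + a * F' i) * G (s ∸ i)} {λ i → F i * G (s ∸ i) + a * (F' i * G (s ∸ i))}
      (λ i _ → solve 4 (λ f f' g a → ((f :+ a :* f') :* g) := (f :* g :+ a :* (f' :* g))) refl (F i) (F' i) (G (s ∸ i)) a))
    (∑-linear (suc s) (λ i → F i * G (s ∸ i)) (λ i → F' i * G (s ∸ i)) a)

  conv-linearʳ : ∀ F G G' a s → conv F (λ i → G i + a * G' i) s ≈ conv F G s + a * conv F G' s
  conv-linearʳ F G G' a s = trans
    (∑-cong (suc s) {λ i → F i * (G (s ∸ i) + a * G' (s ∸ i))} {λ i → F i * G (s ∸ i) + a * (F i * G' (s ∸ i))}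
      (λ i _ → solve 4 (λ f g g' a → (f :* (g :+ a :* g')) := (f :* g :+ a :* (f :* g')))
                       refl (F i) (G (s ∸ i)) (G' (s ∸ i)) a))
    (∑-linear (suc s) (λ i → F i * G (s ∸ i)) (λ i → F i * G' (s ∸ i)) a)

  conv-shiftˡ : ∀ F G s → conv (shift F) G s ≈ shift (conv F G) s
  conv-shiftˡ F G zero = trans (+-identityʳ _) (zeroˡ _)
  conv-shiftˡ F G (suc s) = trans (+-congʳ (zeroˡ _)) (+-identityˡ _)

  conv-shiftʳ : ∀ F G s → conv F (shift G) s ≈ shift (conv F G) s
  conv-shiftʳ F G zero = trans (+-identityʳ _) (zeroʳ _)
  conv-shiftʳ F G (suc zero) = +-congˡ (trans (+-identityʳ _) (zeroʳ _))
  conv-shiftʳ F G (suc (suc s)) = +-congˡ (conv-shiftʳ (λ i → F (suc i)) G (suc s))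

  conv-mulOnePlus : ∀ a F G s → conv (mulOnePlus a F) G s ≈ conv F (mulOnePlus a G) s
  conv-mulOnePlus a F G s = begin
    conv (mulOnePlus a F) G s                ≈⟨ conv-linearˡ F (shift F) G a s ⟩
    conv F G s + a * conv (shift F) G s      ≈⟨ +-congˡ (*-congˡ (trans (conv-shiftˡ F G s) (sym (conv-shiftʳ F G s)))) ⟩
    conv F G s + a * conv F (shift G) s      ≈⟨ sym (conv-linearʳ F G (shift G) a s) ⟩
    conv F (mulOnePlus a G) s                ∎

  -- The series ∏(1 - x t) and ∏(1 - x t)⁻¹ over x ∈ xs.

  E : List Carrier → ℕ → Carrier
  E xs i = pow R (- 1#) i * el R i xs

  H : List Carrier → ℕ → Carrier
  H xs s = hc R s xs

  hc-zero : ∀ xs → hc R 0 xs ≈ 1#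
  hc-zero [] = refl
  hc-zero (x ∷ xs) = trans (+-identityʳ _) (trans (*-identityˡ _) (hc-zero xs))

  sumF-cong : ∀ n {f g : Fin n → Carrier} → (∀ i → f i ≈ g i) → sumF R n f ≈ sumF R n g
  sumF-cong zero _ = refl
  sumF-cong (suc n) f≈g = +-cong (f≈g zero) (sumF-cong n (λ i → f≈g (suc i)))

  sumF-*ˡ : ∀ n a (f : Fin n → Carrier) → sumF R n (λ i → a * f i) ≈ a * sumF R n f
  sumF-*ˡ zero a f = sym (zeroʳ a)
  sumF-*ˡ (suc n) a f = trans (+-congˡ (sumF-*ˡ n a (λ i → f (suc i)))) (sym (distribˡ a _ _))

  hc-suc-∷ : ∀ s x xs → hc R (suc s) (x ∷ xs) ≈ hc R (suc s) xs + x * hc R s (x ∷ xs)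
  hc-suc-∷ s x xs = +-cong (*-identityˡ _) (begin
    sumF R (suc s) (λ i → (x * pow R x (toℕ i)) * hc R (s ∸ toℕ i) xs)
      ≈⟨ sumF-cong (suc s) {λ i → (x * pow R x (toℕ i)) * hc R (s ∸ toℕ i) xs}
           (λ i → *-assoc x (pow R x (toℕ i)) (hc R (s ∸ toℕ i) xs)) ⟩
    sumF R (suc s) (λ i → x * (pow R x (toℕ i) * hc R (s ∸ toℕ i) xs))
      ≈⟨ sumF-*ˡ (suc s) x (λ i → pow R x (toℕ i) * hc R (s ∸ toℕ i) xs) ⟩
    x * sumF R (suc s) (λ i → pow R x (toℕ i) * hc R (s ∸ toℕ i) xs)
      ≡⟨ ≡.cong (x *_) (hc-∷ s) ⟨
    x * hc R s (x ∷ xs)  ∎)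
    where
    hc-∷ : ∀ s → hc R s (x ∷ xs) ≡ sumF R (suc s) (λ i → pow R x (toℕ i) * hc R (s ∸ toℕ i) xs)
    hc-∷ zero = ≡.refl
    hc-∷ (suc s) = ≡.refl

  hc-suc-insert : ∀ U b V s → hc R (suc s) (U ++ b ∷ V) ≈ hc R (suc s) (U ++ V) + b * hc R s (U ++ b ∷ V)
  hc-suc-insert [] b V s = hc-suc-∷ s b V
  hc-suc-insert (u ∷ U) b V zero = begin
    hc R 1 (u ∷ Ub)                                ≈⟨ hc-suc-∷ 0 u Ub ⟩
    hc R 1 Ub + u * hc R 0 (u ∷ Ub)                ≈⟨ +-cong (hc-suc-insert U b V 0) (*-congˡ (hc-zero (u ∷ Ub))) ⟩
    (hc R 1 UV + b * hc R 0 Ub) + u * 1#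
      ≈⟨ +-cong (+-congˡ (*-congˡ (hc-zero Ub))) (sym (*-congˡ (hc-zero (u ∷ UV)))) ⟩
    (hc R 1 UV + b * 1#) + u * hc R 0 (u ∷ UV)
      ≈⟨ solve 3 (λ h b u → ((h :+ b) :+ u) := ((h :+ u) :+ b)) refl _ _ _ ⟩
    (hc R 1 UV + u * hc R 0 (u ∷ UV)) + b * 1#     ≈⟨ +-cong (sym (hc-suc-∷ 0 u UV)) (*-congˡ (sym (hc-zero (u ∷ Ub)))) ⟩
    hc R 1 (u ∷ UV) + b * hc R 0 (u ∷ Ub)          ∎
    where Ub = U ++ b ∷ V ; UV = U ++ V
  hc-suc-insert (u ∷ U) b V (suc s) = begin
    hc R (2 +ℕ s) (u ∷ Ub)                         ≈⟨ hc-suc-∷ (suc s) u Ub ⟩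
    hc R (2 +ℕ s) Ub + u * hc R (suc s) (u ∷ Ub)
      ≈⟨ +-cong (hc-suc-insert U b V (suc s)) (*-congˡ (hc-suc-insert (u ∷ U) b V s)) ⟩
    (hc R (2 +ℕ s) UV + b * hc R (suc s) Ub) + u * (hc R (suc s) (u ∷ UV) + b * hc R s (u ∷ Ub))
      ≈⟨ solve 6 (λ A B C D b u → ((A :+ b :* B) :+ u :* (C :+ b :* D)) := ((A :+ u :* C) :+ b :* (B :+ u :* D)))
                 refl _ _ _ _ _ _ ⟩
    (hc R (2 +ℕ s) UV + u * hc R (suc s) (u ∷ UV)) + b * (hc R (suc s) Ub + u * hc R s (u ∷ Ub))
      ≈⟨ +-cong (sym (hc-suc-∷ (suc s) u UV)) (*-congˡ (sym (hc-suc-∷ s u Ub))) ⟩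
    hc R (2 +ℕ s) (u ∷ UV) + b * hc R (suc s) (u ∷ Ub)  ∎
    where Ub = U ++ b ∷ V ; UV = U ++ V

  E-∷ : ∀ b xs i → E (b ∷ xs) i ≈ mulOnePlus (- b) (E xs) i
  E-∷ b xs zero = sym (trans (+-congˡ (zeroʳ _)) (+-identityʳ _))
  E-∷ b xs (suc i) = begin
    (- 1# * p) * (e₁ + b * e₀)          ≈⟨ *-congʳ (-1*x≈-x p) ⟩
    (- p) * (e₁ + b * e₀)               ≈⟨ distribˡ (- p) e₁ (b * e₀) ⟩
    (- p) * e₁ + (- p) * (b * e₀)       ≈⟨ +-cong (*-congʳ (sym (-1*x≈-x p))) (sym (-‿distribˡ-* p _)) ⟩
    (- 1# * p) * e₁ + - (p * (b * e₀))  ≈⟨ +-congˡ (-‿cong (x∙yz≈y∙xz p b e₀)) ⟩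
    (- 1# * p) * e₁ + - (b * (p * e₀))  ≈⟨ +-congˡ (-‿distribˡ-* b _) ⟩
    (- 1# * p) * e₁ + (- b) * (p * e₀)  ∎
    where p = pow R (- 1#) i ; e₁ = el R (suc i) xs ; e₀ = el R i xs

  H-insert : ∀ U b V s → H (U ++ V) s ≈ mulOnePlus (- b) (H (U ++ b ∷ V)) s
  H-insert U b V zero =
    trans (hc-zero (U ++ V)) (sym (trans (+-cong (hc-zero (U ++ b ∷ V)) (zeroʳ _)) (+-identityʳ _)))
  H-insert U b V (suc s) = begin
    hc R (suc s) (U ++ V)                                  ≈⟨ sym (+-identityʳ _) ⟩
    hc R (suc s) (U ++ V) + 0#                             ≈⟨ +-congˡ (sym (-‿inverseʳ (b * hs))) ⟩
    hc R (suc s) (U ++ V) + (b * hs + - (b * hs))          ≈⟨ sym (+-assoc _ _ _) ⟩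
    (hc R (suc s) (U ++ V) + b * hs) + - (b * hs)          ≈⟨ +-cong (sym (hc-suc-insert U b V s)) (-‿distribˡ-* b hs) ⟩
    hc R (suc s) (U ++ b ∷ V) + (- b) * hs                 ∎
    where hs = hc R s (U ++ b ∷ V)

  conv-E-∷-H-insert : ∀ b xs U V s → conv (E (b ∷ xs)) (H (U ++ b ∷ V)) s ≈ conv (E xs) (H (U ++ V)) s
  conv-E-∷-H-insert b xs U V s = begin
    conv (E (b ∷ xs)) (H (U ++ b ∷ V)) s               ≈⟨ conv-cong {G = H (U ++ b ∷ V)} (E-∷ b xs) (λ _ → refl) s ⟩
    conv (mulOnePlus (- b) (E xs)) (H (U ++ b ∷ V)) s  ≈⟨ conv-mulOnePlus (- b) (E xs) _ s ⟩
    conv (E xs) (mulOnePlus (- b) (H (U ++ b ∷ V))) s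
      ≈⟨ conv-cong {F = E xs} (λ _ → refl) (λ t → sym (H-insert U b V t)) s ⟩
    conv (E xs) (H (U ++ V)) s                         ∎

  conv-E-[]-H : ∀ xs s → conv (E []) (H xs) s ≈ hc R s xs
  conv-E-[]-H xs s = begin
    (1# * 1#) * hc R s xs + ∑ s (λ i → E [] (suc i) * H xs (s ∸ suc i))
      ≈⟨ +-cong (trans (*-congʳ (*-identityˡ 1#)) (*-identityˡ _))
                (∑-zero s {λ i → E [] (suc i) * H xs (s ∸ suc i)} (λ i _ → trans (*-congʳ (zeroʳ _)) (zeroˡ _))) ⟩
    hc R s xs + 0#   ≈⟨ +-identityʳ _ ⟩
    hc R s xs        ∎

  -- The variables of P ++ B cancel one at a time, those of P from the front and those of B
  -- from behind Rs.
  conv-E-H : ∀ P Rs B s → conv (E (P ++ B)) (H (P ++ Rs ++ B)) s ≈ hc R s Rs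
  conv-E-H (x ∷ P) Rs B s = trans (conv-E-∷-H-insert x (P ++ B) [] _ s) (conv-E-H P Rs B s)
  conv-E-H [] Rs (b ∷ B) s = trans (conv-E-∷-H-insert b B Rs B s) (conv-E-H [] Rs B s)
  conv-E-H [] Rs [] s rewrite ++-identityʳ Rs = conv-E-[]-H Rs s

  el-zero : ∀ xs i → length xs < i → el R i xs ≈ 0#
  el-zero [] (suc i) _ = refl
  el-zero (x ∷ xs) (suc i) (s≤s len<i) =
    trans (+-cong (el-zero xs (suc i) (m<n⇒m<1+n len<i)) (trans (*-congˡ (el-zero xs i len<i)) (zeroʳ x)))
          (+-identityʳ 0#)

  E-zero : ∀ xs i → length xs < i → E xs i ≈ 0#
  E-zero xs i len<i = trans (*-congˡ (el-zero xs i len<i)) (zeroʳ _)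

  ∑-atDiff-conv : ∀ D F G s → (∀ i → D < i → F i ≈ 0#) → ∑ (suc D) (λ i → F i * atDiff G s i) ≈ conv F G s
  ∑-atDiff-conv D F G s F≈0 = begin
    ∑ (suc D) f           ≈⟨ ∑-extend (suc D) (suc s) f (λ i D<i → trans (*-congʳ (F≈0 i D<i)) (zeroˡ _)) ⟨
    ∑ (suc D +ℕ suc s) f  ≡⟨ ≡.cong (λ n → ∑ n f) (ℕ.+-comm (suc D) (suc s)) ⟩
    ∑ (suc s +ℕ suc D) f
      ≈⟨ ∑-extend (suc s) (suc D) f (λ i s<i → trans (*-congˡ (reflexive (atDiff-< G s<i))) (zeroʳ _)) ⟩
    ∑ (suc s) f
      ≈⟨ ∑-cong (suc s) {f} {λ i → F i * G (s ∸ i)} (λ i i≤s → *-congˡ (reflexive (atDiff-≤ G (≤-pred i≤s)))) ⟩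
    conv F G s            ∎
    where f = λ i → F i * atDiff G s i

  ∑-E-atDiff-H : ∀ P Rs B m n →
    ∑ (suc (length (P ++ B))) (λ i → E (P ++ B) i * atDiff (H (P ++ Rs ++ B)) m (n +ℕ i)) ≈ atDiff (H Rs) m n
  ∑-E-atDiff-H P Rs B m n with n ≤? m
  ... | yes n≤m with m≤n⇒∃[o]m+o≡n n≤m
  ...   | s , ≡.refl = begin
    ∑ (suc D) (λ i → E x' i * atDiff (H x) (n +ℕ s) (n +ℕ i))
      ≈⟨ ∑-cong (suc D) {λ i → E x' i * atDiff (H x) (n +ℕ s) (n +ℕ i)} {λ i → E x' i * atDiff (H x) s i}
           (λ i _ → *-congˡ (reflexive (atDiff-cong (H x) (n +ℕ s) (n +ℕ i) s i (reassoc n s i)))) ⟩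
    ∑ (suc D) (λ i → E x' i * atDiff (H x) s i)   ≈⟨ ∑-atDiff-conv D (E x') (H x) s (E-zero x') ⟩
    conv (E x') (H x) s                           ≈⟨ conv-E-H P Rs B s ⟩
    hc R s Rs                                     ≡⟨ atDiff-+ (H Rs) n s ⟨
    atDiff (H Rs) (n +ℕ s) n                      ∎
    where
    x' = P ++ B ; x = P ++ Rs ++ B ; D = length x'
    reassoc : ∀ n s i → (n +ℕ s) +ℕ i ≡ s +ℕ (n +ℕ i)
    reassoc = solve-∀
  ∑-E-atDiff-H P Rs B m n | no n≰m = trans
    (∑-zero (suc (length (P ++ B))) {λ i → E (P ++ B) i * atDiff (H (P ++ Rs ++ B)) m (n +ℕ i)}
      (λ i _ → trans (*-congˡ (reflexive (atDiff-< (H (P ++ Rs ++ B)) (≤-trans (≰⇒> n≰m) (m≤m+n n i))))) (zeroʳ _)))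
    (reflexive (≡.sym (atDiff-< (H Rs) (≰⇒> n≰m))))

  fromℕ-+ : ∀ m n → fromℕ R (m +ℕ n) ≈ fromℕ R m + fromℕ R n
  fromℕ-+ zero n = sym (+-identityˡ _)
  fromℕ-+ (suc m) n = trans (+-congˡ (fromℕ-+ m n)) (sym (+-assoc _ _ _))

  fromℕ-1* : ∀ z → fromℕ R 1 * z ≈ z
  fromℕ-1* z = trans (*-congʳ (+-identityʳ 1#)) (*-identityˡ z)

  hc-[-] : ∀ s x → hc R s (x ∷ []) ≈ pow R x s
  hc-[-] zero x = hc-zero (x ∷ [])
  hc-[-] (suc s) x = trans (hc-suc-∷ s x []) (trans (+-identityˡ _) (*-congˡ (hc-[-] s x)))

  hc-replicate : ∀ r s x → hc R s (replicate (suc r) x) ≈ fromℕ R ((s +ℕ r) C r) * pow R x s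
  hc-replicate zero s x = trans (hc-[-] s x) (sym (fromℕ-1* _))
  hc-replicate (suc r) zero x = trans (hc-zero (replicate (2 +ℕ r) x))
    (sym (trans (*-congʳ (reflexive (≡.cong (fromℕ R) (nCn≡1 (suc r))))) (fromℕ-1* 1#)))
  hc-replicate (suc r) (suc s) x = begin
    hc R (suc s) (x ∷ xs)                         ≈⟨ hc-suc-∷ s x xs ⟩
    hc R (suc s) xs + x * hc R s (x ∷ xs)         ≈⟨ +-cong (hc-replicate r (suc s) x) (*-congˡ (hc-replicate (suc r) s x)) ⟩
    fromℕ R A * (x * pow R x s) + x * (fromℕ R B * pow R x s)
      ≈⟨ solve 4 (λ a b x p → (a :* (x :* p) :+ x :* (b :* p)) := ((a :+ b) :* (x :* p)))
                 refl (fromℕ R A) (fromℕ R B) x (pow R x s) ⟩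
    (fromℕ R A + fromℕ R B) * pow R x (suc s)                  ≈⟨ *-congʳ (sym (fromℕ-+ A B)) ⟩
    fromℕ R (A +ℕ B) * pow R x (suc s)                         ≡⟨ ≡.cong (λ k → fromℕ R k * pow R x (suc s)) pascal ⟩
    fromℕ R ((suc s +ℕ suc r) C suc r) * pow R x (suc s)       ∎
    where
    xs = replicate (suc r) x
    A = (suc s +ℕ r) C r
    B = (s +ℕ suc r) C suc r
    pascal : A +ℕ B ≡ (suc s +ℕ suc r) C suc r
    pascal = ≡.trans (≡.cong (λ k → A +ℕ k C suc r) (+-suc s r))
               (≡.trans (nCk+nC[k+1]≡[n+1]C[k+1] (suc s +ℕ r) r) (≡.cong (λ k → k C suc r) (≡.sym (+-suc (suc s) r))))

  hc-replicate-∸ : ∀ a r x → r ≤ a → hc R (a ∸ r) (replicate (suc r) x) ≈ fromℕ R (a C r) * pow R x (a ∸ r)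
  hc-replicate-∸ a r x r≤a =
    trans (hc-replicate r (a ∸ r) x) (reflexive (≡.cong (λ k → fromℕ R (k C r) * pow R x (a ∸ r)) (m∸n+n≡m r≤a)))

  data Split {n} (y : Vec Carrier n) (κ : Vec ℕ n) : Fin n × ℕ → Set c where
    split : ∀ q r P B → rep R y κ ≡ P ++ replicate (suc r) (lookup y q) ++ B →
            repMinus R y κ q (suc r) ≡ P ++ B → Split y κ (q , suc r)

  decomp-split : ∀ {n} (y : Vec Carrier n) κ p → Split y κ (decomp κ p)
  decomp-split (y₀ ∷ y) (k ∷ κ) p with splitAt k p
  ... | inj₁ i = split zero (toℕ i) [] (replicate (k ∸ suc (toℕ i)) y₀ ++ rep R y κ) block ≡.refl
    where
    block : replicate k y₀ ++ rep R y κ ≡ replicate (suc (toℕ i)) y₀ ++ replicate (k ∸ suc (toℕ i)) y₀ ++ rep R y κ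
    block = ≡.trans (≡.cong (λ m → replicate m y₀ ++ rep R y κ) (≡.sym (m+[n∸m]≡n (toℕ<n i))))
              (≡.trans (≡.cong (_++ rep R y κ) (replicate-+ (suc (toℕ i)) _ y₀))
                       (++-assoc (replicate (suc (toℕ i)) y₀) _ _))
  ... | inj₂ i with decomp κ i | decomp-split y κ i
  ...   | _ | split q r P B e₁ e₂ = split (suc q) r (replicate k y₀ ++ P) B
    (≡.trans (≡.cong (replicate k y₀ ++_) e₁) (≡.sym (++-assoc (replicate k y₀) P _)))
    (≡.trans (≡.cong (replicate k y₀ ++_) e₂) (≡.sym (++-assoc (replicate k y₀) P B)))

  length-rep : ∀ {n} (y : Vec Carrier n) κ → length (rep R y κ) ≡ sum κ
  length-rep [] [] = ≡.refl
  length-rep (y₀ ∷ y) (k ∷ κ) =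
    ≡.trans (length-++ (replicate k y₀)) (≡.cong₂ _+ℕ_ (length-replicate k) (length-rep y κ))

  length-++-replicate : ∀ P r (x : Carrier) B → length (P ++ replicate (suc r) x ++ B) ≡ suc (length (P ++ B)) +ℕ r
  length-++-replicate P r x B = ≡.trans (length-++ P)
    (≡.trans (≡.cong (length P +ℕ_)
                     (≡.trans (length-++ (replicate (suc r) x)) (≡.cong (_+ℕ length B) (length-replicate (suc r)))))
      (≡.trans (regroup (length P) (length B) r) (≡.cong (λ d → suc d +ℕ r) (≡.sym (length-++ P)))))
    where
    regroup : ∀ p b r → p +ℕ (suc r +ℕ b) ≡ suc (p +ℕ b) +ℕ r
    regroup = solve-∀

  -- The paper's reindexing i = N - k - r + 1, which reads i = D - k here.
  ∑-J-M : ∀ D r lj J x x' →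
    ∑ (suc D +ℕ r) (λ k → atDiff (H x) (lj +ℕ suc k) (suc J) * atDiff (E x') (suc (suc D +ℕ r)) (suc k +ℕ suc r))
    ≈ ∑ (suc D) (λ i → E x' i * atDiff (H x) (lj +ℕ suc D) (suc J +ℕ i))
  ∑-J-M D r lj J x x' = begin
    ∑ (suc D +ℕ r) (λ k → Jk k * atDiff (E x') (suc (suc D +ℕ r)) (suc k +ℕ suc r))
      ≈⟨ ∑-cong (suc D +ℕ r) {λ k → Jk k * atDiff (E x') (suc (suc D +ℕ r)) (suc k +ℕ suc r)} {f}
           (λ k _ → *-congˡ (reflexive (atDiff-cong (E x') _ _ D k (shuffle D r k)))) ⟩
    ∑ (suc D +ℕ r) f
      ≈⟨ ∑-extend (suc D) r f (λ k D<k → trans (*-congˡ (reflexive (atDiff-< (E x') D<k))) (zeroʳ _)) ⟩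
    ∑ (suc D) f                ≈⟨ ∑-reverse (suc D) f ⟩
    ∑ (suc D) (λ i → f (D ∸ i))
      ≈⟨ ∑-cong (suc D) {λ i → f (D ∸ i)} {λ i → E x' i * atDiff (H x) (lj +ℕ suc D) (suc J +ℕ i)}
           (λ i i≤D → trans (*-comm _ _)
                            (*-cong (reflexive (E-at i (≤-pred i≤D))) (reflexive (J-at i (≤-pred i≤D))))) ⟩
    ∑ (suc D) (λ i → E x' i * atDiff (H x) (lj +ℕ suc D) (suc J +ℕ i))  ∎
    where
    Jk = λ k → atDiff (H x) (lj +ℕ suc k) (suc J)
    f = λ k → Jk k * atDiff (E x') D k
    shuffle : ∀ D r k → suc (suc D +ℕ r) +ℕ k ≡ D +ℕ (suc k +ℕ suc r)
    shuffle = solve-∀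
    E-at : ∀ i → i ≤ D → atDiff (E x') D (D ∸ i) ≡ E x' i
    E-at i i≤D = atDiff-cong (E x') D (D ∸ i) i 0 (≡.trans (ℕ.+-identityʳ D) (≡.sym (m+[n∸m]≡n i≤D)))
    J-at : ∀ i → i ≤ D → Jk (D ∸ i) ≡ atDiff (H x) (lj +ℕ suc D) (suc J +ℕ i)
    J-at i i≤D = atDiff-cong (H x) (lj +ℕ suc (D ∸ i)) (suc J) (lj +ℕ suc D) (suc J +ℕ i)
      (≡.trans (regroup lj (D ∸ i) J i) (≡.cong (λ d → (lj +ℕ suc d) +ℕ suc J) (m∸n+n≡m i≤D)))
      where
      regroup : ∀ lj u J i → (lj +ℕ suc u) +ℕ (suc J +ℕ i) ≡ (lj +ℕ suc (u +ℕ i)) +ℕ suc J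
      regroup = solve-∀

  -- r, J and k are the paper's r - 1, j - 1 and k - 1.
  G≈J*M-entry : ∀ {x x'} P r c B N J lj → x ≡ P ++ replicate (suc r) c ++ B → x' ≡ P ++ B →
    J < N → length x ≡ N →
    let a = N +ℕ lj ∸ suc J in
    (if suc r ≤ᵇ suc a then fromℕ R (a C r) * pow R c (a ∸ r) else 0#)
    ≈ sumF R N (λ k → atDiff (H x) (lj +ℕ suc (toℕ k)) (suc J) * atDiff (E x') (suc N) (suc (toℕ k) +ℕ suc r))
  G≈J*M-entry P r c B N J lj ≡.refl ≡.refl J<N len-x with ≡.trans (≡.sym len-x) (length-++-replicate P r c B)
  ... | ≡.refl = begin
    (if suc r ≤ᵇ suc a then fromℕ R (a C r) * pow R c (a ∸ r) else 0#)
      ≈⟨ if-cong (suc r ≤ᵇ suc a) (λ t → hc-replicate-∸ a r c (≤-pred (≤ᵇ⇒≤ (suc r) (suc a) t))) ⟨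
    atDiff (H Rs) (suc a) (suc r)        ≡⟨ atDiff-cong (H Rs) (suc a) (suc r) (lj +ℕ suc D) (suc J) a+J≡ ⟩
    atDiff (H Rs) (lj +ℕ suc D) (suc J)  ≈⟨ ∑-E-atDiff-H P Rs B (lj +ℕ suc D) (suc J) ⟨
    ∑ (suc D) (λ i → E x' i * atDiff (H x) (lj +ℕ suc D) (suc J +ℕ i))  ≈⟨ ∑-J-M D r lj J x x' ⟨
    ∑ N JM                               ≡⟨ sumF-toℕ N JM ⟨
    sumF R N (λ k → JM (toℕ k))          ∎
    where
    Rs = replicate (suc r) c
    x = P ++ Rs ++ B
    x' = P ++ B
    D = length x'
    a = N +ℕ lj ∸ suc J
    JM = λ k → atDiff (H x) (lj +ℕ suc k) (suc J) * atDiff (E x') (suc N) (suc k +ℕ suc r)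
    regroup : ∀ D r lj → suc ((suc D +ℕ r) +ℕ lj) ≡ (lj +ℕ suc D) +ℕ suc r
    regroup = solve-∀
    a+J≡ : suc a +ℕ suc J ≡ (lj +ℕ suc D) +ℕ suc r
    a+J≡ = ≡.trans (≡.cong suc (m∸n+n≡m (≤-trans J<N (m≤m+n N lj)))) (regroup D r lj)

proposition5p4 : ∀ {c ℓ} (R : CommutativeRing c ℓ) (n : ℕ) (κ : Vec ℕ n)
    (y : Vec (CommutativeRing.Carrier R) n) (lam : List ℕ) →
    IsPartition lam → length lam ≤ sum κ →
    ∀ (j p : Fin (sum κ)) →
    CommutativeRing._≈_ R (Gmat R y κ lam j p) (matMul R (Jmat R y κ lam) (Mmat R y κ) j p)
proposition5p4 R n κ y lam _ _ j p with decomp κ p | decomp-split R y κ p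
... | _ | split q r P B e₁ e₂ =
  G≈J*M-entry R P r (lookup y q) B (sum κ) (toℕ j) (nth lam (toℕ j)) e₁ e₂ (toℕ<n j) (length-rep R y κ)
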